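{- For every $n\geq 4$ and all positive integers $p,q,r$ with $p+q+r=n$, there is a quasimetric space $\mathcal{Q}$ of size $n$ such that $\mathcal{L}_\mathcal{Q}=\{\ell_1,\ell_2,\ell_3\}$ with $|\ell_1|=p+q$, $|\ell_2|=p+r$ and $|\ell_3|=q+r$.
   Context: A quasimetric space is a pair $(Q,\rho)$ where $Q$ is a set and $\rho:Q\times Q\to[0,\infty)$ satisfies $\rho(x,y)=0\iff x=y$ and $\rho(x,y)\le \rho(x,z)+\rho(z,y)$ for all $x,y,z\in Q$ ($\rho$ need not be symmetric); its size is $|Q|$. For $a,b\in Q$ let $[ab]=\{c\in Q:\rho(a,b)=\rho(a,c)+\rho(c,b)\}$. For distinct $a,b\in Q$, the line $\overrightarrow{ab}=\{c\in Q: a\in[cb]\ \text{or}\ c\in[ab]\ \text{or}\ b\in[ac]\}$. $\mathcal{L}_\mathcal{Q}$ is the set of all lines $\overrightarrow{ab}$ with $a\neq b$. -}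

module Defs where

open import Data.Nat using (ℕ)
open import Data.Fin using (Fin)
open import Data.Fin.Subset using (Subset)
open import Data.Vec using (tabulate)
open import Data.Rational using (ℚ; 0ℚ; _+_; _≤_; _≟_)
open import Data.Bool using (Bool; _∨_)
open import Data.Product using (_×_; Σ; ∃)
open import Relation.Nullary using (¬_)
open import Relation.Nullary.Decidable using (⌊_⌋)
open import Relation.Binary.PropositionalEquality using (_≡_)

Dist : ℕ → Set
Dist n = Fin n → Fin n → ℚ

record IsQuasimetric {n : ℕ} (ρ : Dist n) : Set where
  field
    nonneg   : ∀ x y → 0ℚ ≤ ρ x y
    zero⇒eq  : ∀ x y → ρ x y ≡ 0ℚ → x ≡ y
    eq⇒zero  : ∀ x → ρ x x ≡ 0ℚ
    triangle : ∀ x y z → ρ x y ≤ ρ x z + ρ z y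

-- c ∈ [ab]  iff  ρ(a,b) = ρ(a,c) + ρ(c,b)  (as a Boolean test)
between : {n : ℕ} → Dist n → Fin n → Fin n → Fin n → Bool
between ρ a b c = ⌊ ρ a b ≟ ρ a c + ρ c b ⌋

line : {n : ℕ} → Dist n → Fin n → Fin n → Subset n
line ρ a b = tabulate (λ c → between ρ c b a ∨ (between ρ a b c ∨ between ρ a c b))

IsLine : {n : ℕ} → Dist n → Subset n → Set
IsLine ρ ℓ = Σ _ λ a → Σ _ λ b → ¬ (a ≡ b) × line ρ a b ≡ ℓ

-- The space is a "ladder" of three classes of sizes p, q, r, cyclically ordered
-- P → Q → R → P. Inside a class the points sit on a segment of ℕ; between classes
-- every path pays a large toll H and passes through fixed portals: forwards
-- (X to next X) from the top of X to the top of next X, backwards from bottom to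
-- bottom. The toll makes every betweenness involving three classes fail, so the
-- line through points of two different classes is exactly the union of those
-- classes. The portals are placed so that the line through two points i ≠ j of
-- one class X picks up next X when i < j and prev X when i > j; hence every line
-- is the complement of a single class.
module Submission where

open import Defs
open import Data.Nat
  using (ℕ; zero; suc; _+_; _≤_; _<_; _≥_; _>_; z≤n; s≤s; ∣_-_∣; _≤?_)
import Data.Nat as ℕ
open import Data.Nat.Properties
  using ( ≤-trans; ≤-total; ≤-antisym; <-≤-trans; <⇒≤; <⇒≢; ≮⇒≥; ≰⇒≥; n<1+n
        ; m≤m+n; m≤n+m; +-assoc; +-comm; +-identityʳ; +-cancelˡ-≡; +-cancelʳ-≡
        ; +-mono-≤; +-monoˡ-≤; +-monoʳ-≤; +-monoʳ-<; m+n≡0⇒m≡0; m+[n∸m]≡n; ⊔-lub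
        ; ∣-∣-comm; ∣-∣-triangle; ∣m-n∣≡0⇒m≡n; ∣n-n∣≡0; ∣m-n∣≤m⊔n; m≤n⇒∣m-n∣≡n∸m
        ; module ≤-Reasoning )
import Data.Integer as ℤ
import Data.Integer.Properties as ℤ
open import Data.Rational using (ℚ; mkℚ; *≤*)
import Data.Rational as ℚ
import Data.Rational.Properties as ℚ
import Data.Rational.Unnormalised as ℚᵘ
import Data.Rational.Unnormalised.Properties as ℚᵘ
open import Data.Nat.Coprimality using (1-coprimeTo) renaming (sym to coprime-sym)
open import Data.Fin using (Fin; toℕ; splitAt; join; _↑ˡ_; _↑ʳ_)
import Data.Fin as Fin
open import Data.Fin.Properties
  using (toℕ≤pred[n]; toℕ-injective; splitAt-↑ˡ; splitAt-↑ʳ; join-splitAt)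
open import Data.Fin.Subset using (Subset; ∣_∣)
open import Data.Vec using (tabulate; lookup)
open import Data.Vec.Properties using (tabulate-cong; lookup∘tabulate)
open import Data.Bool using (Bool; true; false; _∨_; if_then_else_)
open import Data.Sum using (_⊎_; inj₁; inj₂; [_,_]′)
import Data.Sum as Sum
open import Data.Product using (_×_; Σ; _,_; proj₁)
open import Function using (_∘_; id; _⇔_; mk⇔; Equivalence)
open import Function.Construct.Composition using (_⇔-∘_)
open import Relation.Nullary using (¬_; Dec; yes; no; does; contradiction; ¬?)
open import Relation.Nullary.Decidable
  using (_⊎-dec_; does-⇔; isYes≗does; dec-true; dec-false)
open import Relation.Binary.Definitions using (DecidableEquality)
open import Relation.Binary.PropositionalEquality

open Equivalence using (to; from)

ι : ℕ → ℚ
ι n = mkℚ (ℤ.+ n) 0 (coprime-sym (1-coprimeTo n))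

ι-+ : ∀ m n → ι m ℚ.+ ι n ≡ ι (m + n)
ι-+ m n = ℚ.toℚᵘ-injective (ℚᵘ.≃-trans (ℚ.toℚᵘ-homo-+ (ι m) (ι n)) (ℚᵘ.*≡* (begin
  (ℤ.+ m ℤ.* ℤ.+ 1 ℤ.+ ℤ.+ n ℤ.* ℤ.+ 1) ℤ.* ℤ.+ 1 ≡⟨ ℤ.*-identityʳ _ ⟩
  ℤ.+ m ℤ.* ℤ.+ 1 ℤ.+ ℤ.+ n ℤ.* ℤ.+ 1             ≡⟨ cong₂ ℤ._+_ (ℤ.*-identityʳ (ℤ.+ m))
                                                                 (ℤ.*-identityʳ (ℤ.+ n)) ⟩
  ℤ.+ m ℤ.+ ℤ.+ n                                 ≡⟨ ℤ.pos-+ m n ⟨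
  ℤ.+ (m + n)                                     ≡⟨ ℤ.*-identityʳ _ ⟨
  ℤ.+ (m + n) ℤ.* ℤ.+ 1                           ∎)))
  where open ≡-Reasoning

ι-injective : ∀ {m n} → ι m ≡ ι n → m ≡ n
ι-injective = cong (ℤ.∣_∣ ∘ ℚ.↥_)

ι-mono : ∀ {m n} → m ≤ n → ι m ℚ.≤ ι n
ι-mono {m} {n} m≤n = *≤* (subst₂ ℤ._≤_ (sym (ℤ.*-identityʳ (ℤ.+ m)))
                                      (sym (ℤ.*-identityʳ (ℤ.+ n))) (ℤ.+≤+ m≤n))

ι-isQuasimetric : ∀ {n} (d : Fin n → Fin n → ℕ) →
  (∀ x y → d x y ≡ 0 → x ≡ y) → (∀ x → d x x ≡ 0) →
  (∀ x y z → d x y ≤ d x z + d z y) → IsQuasimetric (λ x y → ι (d x y))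
ι-isQuasimetric d d≡0⇒≡ d-self d-triangle = record
  { nonneg   = λ _ _ → ι-mono z≤n
  ; zero⇒eq  = λ x y ιd≡0 → d≡0⇒≡ x y (ι-injective ιd≡0)
  ; eq⇒zero  = λ x → cong ι (d-self x)
  ; triangle = λ x y z →
      subst (ι (d x y) ℚ.≤_) (sym (ι-+ (d x z) (d z y))) (ι-mono (d-triangle x y z))
  }

-- Lines of a ℕ-valued distance

Collinear : {A : Set} → (A → A → ℕ) → A → A → A → Set
Collinear d a b c = d c b ≡ d c a + d a b ⊎ d a b ≡ d a c + d c b ⊎ d a c ≡ d a b + d b c

collinear? : {A : Set} (d : A → A → ℕ) (a b c : A) → Dec (Collinear d a b c)
collinear? d a b c =
  d c b ℕ.≟ d c a + d a b ⊎-dec d a b ℕ.≟ d a c + d c b ⊎-dec d a c ℕ.≟ d a b + d b c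

between-ι : ∀ {n} (d : Fin n → Fin n → ℕ) a b c →
  between (λ x y → ι (d x y)) a b c ≡ does (d a b ℕ.≟ d a c + d c b)
between-ι d a b c = trans (isYes≗does ι?) (does-⇔ ι-sum⇔ ι? (d a b ℕ.≟ d a c + d c b))
  where
  ι? : Dec (ι (d a b) ≡ ι (d a c) ℚ.+ ι (d c b))
  ι? = ι (d a b) ℚ.≟ ι (d a c) ℚ.+ ι (d c b)
  ι-sum⇔ : ι (d a b) ≡ ι (d a c) ℚ.+ ι (d c b) ⇔ d a b ≡ d a c + d c b
  ι-sum⇔ = mk⇔ (λ e → ι-injective (trans e (ι-+ (d a c) (d c b))))
                (λ e → trans (cong ι e) (sym (ι-+ (d a c) (d c b))))

line-ι : ∀ {n} (d : Fin n → Fin n → ℕ) a b →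
  line (λ x y → ι (d x y)) a b ≡ tabulate (does ∘ collinear? d a b)
line-ι d a b = tabulate-cong λ c →
  cong₂ _∨_ (between-ι d c b a) (cong₂ _∨_ (between-ι d a b c) (between-ι d a c b))

-- Betweenness on ℕ

Between : ℕ → ℕ → ℕ → Set
Between x k y = ∣ x - y ∣ ≡ ∣ x - k ∣ + ∣ k - y ∣

≤-between : ∀ {x k y} → x ≤ k → k ≤ y → Between x k y
≤-between {zero} {k} _ k≤y =
  sym (trans (cong (k +_) (m≤n⇒∣m-n∣≡n∸m k≤y)) (m+[n∸m]≡n k≤y))
≤-between (s≤s x≤k) (s≤s k≤y) = ≤-between x≤k k≤y

between-sym : ∀ x k y → Between x k y → Between y k x
between-sym x k y x-k-y = begin
  ∣ y - x ∣             ≡⟨ ∣-∣-comm y x ⟩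
  ∣ x - y ∣             ≡⟨ x-k-y ⟩
  ∣ x - k ∣ + ∣ k - y ∣ ≡⟨ +-comm ∣ x - k ∣ ∣ k - y ∣ ⟩
  ∣ k - y ∣ + ∣ x - k ∣ ≡⟨ cong₂ _+_ (∣-∣-comm k y) (∣-∣-comm x k) ⟩
  ∣ y - k ∣ + ∣ k - x ∣ ∎
  where open ≡-Reasoning

≥-between : ∀ {x k y} → y ≤ k → k ≤ x → Between x k y
≥-between {x} {k} {y} y≤k k≤x = between-sym y k x (≤-between y≤k k≤x)

between-0 : ∀ {k y} → Between 0 k y → k ≤ y
between-0 {k} 0-k-y = subst (k ≤_) (sym 0-k-y) (m≤m+n k _)

between-≤ : ∀ {x k y} → x ≤ y → Between x k y → x ≤ k
between-≤ {x} {k} {y} x≤y x-k-y = ≮⇒≥ λ k<x →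
  <⇒≢ k<x (sym (∣m-n∣≡0⇒m≡n (m+n≡0⇒m≡0 ∣ x - k ∣ (detour≡0 k<x))))
  where
  open ≡-Reasoning
  detour≡0 : k < x → ∣ x - k ∣ + ∣ k - x ∣ ≡ 0
  detour≡0 k<x = +-cancelʳ-≡ ∣ x - y ∣ _ 0 (begin
    ∣ x - k ∣ + ∣ k - x ∣ + ∣ x - y ∣   ≡⟨ +-assoc ∣ x - k ∣ _ _ ⟩
    ∣ x - k ∣ + (∣ k - x ∣ + ∣ x - y ∣) ≡⟨ cong (∣ x - k ∣ +_) (≤-between (<⇒≤ k<x) x≤y) ⟨
    ∣ x - k ∣ + ∣ k - y ∣               ≡⟨ x-k-y ⟨
    ∣ x - y ∣                           ∎)

between-total : ∀ i j k → Between k i j ⊎ Between i k j ⊎ Between i j k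
between-total i j k with ≤-total i j | ≤-total j k | ≤-total i k
... | inj₁ i≤j | inj₁ j≤k | _        = inj₂ (inj₂ (≤-between i≤j j≤k))
... | inj₁ i≤j | inj₂ k≤j | inj₁ i≤k = inj₂ (inj₁ (≤-between i≤k k≤j))
... | inj₁ i≤j | inj₂ k≤j | inj₂ k≤i = inj₁ (≤-between k≤i i≤j)
... | inj₂ j≤i | inj₁ j≤k | inj₁ i≤k = inj₁ (≥-between j≤i i≤k)
... | inj₂ j≤i | inj₁ j≤k | inj₂ k≤i = inj₂ (inj₁ (≥-between j≤k k≤i))
... | inj₂ j≤i | inj₂ k≤j | _        = inj₂ (inj₂ (≥-between k≤j j≤i))

endpoint-between : ∀ {i k e} → i ≤ e → k ≤ e → Between i k e ⊎ Between k i e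
endpoint-between {i} {k} i≤e k≤e with ≤-total i k
... | inj₁ i≤k = inj₁ (≤-between i≤k k≤e)
... | inj₂ k≤i = inj₂ (≤-between k≤i i≤e)

zero-endpoint-between : ∀ i k → Between i k 0 ⊎ Between k i 0
zero-endpoint-between i k with ≤-total i k
... | inj₁ i≤k = inj₂ (≥-between z≤n i≤k)
... | inj₂ k≤i = inj₁ (≥-between z≤n k≤i)

+-eq-transport : ∀ {a b c a′ b′ c′ : ℕ} → a ≡ a′ → b ≡ b′ → c ≡ c′ → a ≡ b + c ⇔ a′ ≡ b′ + c′
+-eq-transport refl refl refl = mk⇔ id id

∣-∣-bounded : ∀ {u v b} → u ≤ b → v ≤ b → ∣ u - v ∣ ≤ b
∣-∣-bounded {u} {v} u≤b v≤b = ≤-trans (∣m-n∣≤m⊔n u v) (⊔-lub u≤b v≤b)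

data Cls : Set where
  P Q R : Cls

next prev : Cls → Cls
next P = Q
next Q = R
next R = P
prev P = R
prev Q = P
prev R = Q

next≢ : ∀ X → next X ≢ X
next≢ P ()
next≢ Q ()
next≢ R ()

prev≢ : ∀ X → prev X ≢ X
prev≢ P ()
prev≢ Q ()
prev≢ R ()

prev≢next : ∀ X → prev X ≢ next X
prev≢next P ()
prev≢next Q ()
prev≢next R ()

data Position (X : Cls) : Cls → Set where
  same   : Position X X
  ahead  : Position X (next X)
  behind : Position X (prev X)

position : ∀ X Y → Position X Y
position P P = same
position P Q = ahead
position P R = behind
position Q P = behind
position Q Q = same
position Q R = ahead
position R P = ahead
position R Q = behind
position R R = same

_≟_ : DecidableEquality Cls
X ≟ Y with position X Y
... | same   = yes refl
... | ahead  = no (next≢ X ∘ sym)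
... | behind = no (prev≢ X ∘ sym)

join-of-split : ∀ {m n} {x : Fin (m + n)} {s} → splitAt m x ≡ s → join m n s ≡ x
join-of-split {m} {n} {x} refl = join-splitAt m n x

∣tabulate-+∣ : ∀ m n (f : Fin (m + n) → Bool) →
  ∣ tabulate f ∣ ≡ ∣ tabulate (f ∘ (_↑ˡ n)) ∣ + ∣ tabulate (f ∘ (m ↑ʳ_)) ∣
∣tabulate-+∣ zero    n f = refl
∣tabulate-+∣ (suc m) n f with f Fin.zero | ∣tabulate-+∣ m n (f ∘ Fin.suc)
... | true  | ih = cong suc ih
... | false | ih = ih

∣tabulate-const∣ : ∀ n b → ∣ tabulate {n = n} (λ _ → b) ∣ ≡ (if b then n else 0)
∣tabulate-const∣ zero    true  = refl
∣tabulate-const∣ zero    false = refl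
∣tabulate-const∣ (suc n) true  = cong suc (∣tabulate-const∣ n true)
∣tabulate-const∣ (suc n) false = ∣tabulate-const∣ n false

-- The ladder with classes of sizes suc (top X)

module Ladder (top : Cls → ℕ) where

  size : Cls → ℕ
  size X = suc (top X)

  Index : Cls → Set
  Index X = Fin (size X)

  Point : Set
  Point = Σ Cls Index

  B : ℕ
  B = top P + top Q + top R

  top≤B : ∀ X → top X ≤ B
  top≤B P = ≤-trans (m≤m+n (top P) (top Q)) (m≤m+n _ (top R))
  top≤B Q = ≤-trans (m≤n+m (top Q) (top P)) (m≤m+n _ (top R))
  top≤B R = m≤n+m (top R) _

  index≤B : ∀ {X} (i : Index X) → toℕ i ≤ B
  index≤B {X} i = ≤-trans (toℕ≤pred[n] i) (top≤B X)

  -- Any route through a third class costs at least 2H, more than any distance.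
  H : ℕ
  H = suc (B + B)

  crossing : ℕ → ℕ → ℕ → ℕ → ℕ
  crossing e e′ i j = ∣ i - e ∣ + H + ∣ e′ - j ∣

  crossing-≥ : ∀ e e′ i j → H ≤ crossing e e′ i j
  crossing-≥ e e′ i j = ≤-trans (m≤n+m H ∣ i - e ∣) (m≤m+n _ ∣ e′ - j ∣)

  crossing-< : ∀ e e′ i j → ∣ i - e ∣ ≤ B → ∣ e′ - j ∣ ≤ B → crossing e e′ i j < H + H
  crossing-< e e′ i j i-e≤B e′-j≤B = begin-strict
    ∣ i - e ∣ + H + ∣ e′ - j ∣ ≤⟨ +-mono-≤ (+-monoˡ-≤ H i-e≤B) e′-j≤B ⟩
    B + H + B                 ≡⟨ cong (_+ B) (+-comm B H) ⟩
    H + B + B                 ≡⟨ +-assoc H B B ⟩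
    H + (B + B)               <⟨ +-monoʳ-< H (n<1+n (B + B)) ⟩
    H + H                     ∎
    where open ≤-Reasoning

  crossing-reassocˡ : ∀ e e′ i j k →
    ∣ i - k ∣ + crossing e e′ k j ≡ ∣ i - k ∣ + ∣ k - e ∣ + H + ∣ e′ - j ∣
  crossing-reassocˡ e e′ i j k = trans (sym (+-assoc ∣ i - k ∣ _ ∣ e′ - j ∣))
                                  (cong (_+ ∣ e′ - j ∣) (sym (+-assoc ∣ i - k ∣ ∣ k - e ∣ H)))

  crossing-reassocʳ : ∀ e e′ i j k →
    crossing e e′ i k + ∣ k - j ∣ ≡ ∣ i - e ∣ + H + (∣ e′ - k ∣ + ∣ k - j ∣)
  crossing-reassocʳ e e′ i j k = +-assoc (∣ i - e ∣ + H) ∣ e′ - k ∣ ∣ k - j ∣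

  crossing-triangleˡ : ∀ e e′ i j k → crossing e e′ i j ≤ ∣ i - k ∣ + crossing e e′ k j
  crossing-triangleˡ e e′ i j k = subst (crossing e e′ i j ≤_) (sym (crossing-reassocˡ e e′ i j k))
    (+-monoˡ-≤ ∣ e′ - j ∣ (+-monoˡ-≤ H (∣-∣-triangle i k e)))

  crossing-triangleʳ : ∀ e e′ i j k → crossing e e′ i j ≤ crossing e e′ i k + ∣ k - j ∣
  crossing-triangleʳ e e′ i j k = subst (crossing e e′ i j ≤_) (sym (crossing-reassocʳ e e′ i j k))
    (+-monoʳ-≤ (∣ i - e ∣ + H) (∣-∣-triangle e′ k j))

  crossing-splitˡ : ∀ e e′ i j k → crossing e e′ i j ≡ ∣ i - k ∣ + crossing e e′ k j ⇔ Between i k e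
  crossing-splitˡ e e′ i j k =
    subst (λ t → crossing e e′ i j ≡ t ⇔ Between i k e) (sym (crossing-reassocˡ e e′ i j k))
      (mk⇔ (+-cancelʳ-≡ H _ _ ∘ +-cancelʳ-≡ ∣ e′ - j ∣ _ _) (cong (λ t → t + H + ∣ e′ - j ∣)))

  crossing-splitʳ : ∀ e e′ i j k → crossing e e′ i j ≡ crossing e e′ i k + ∣ k - j ∣ ⇔ Between e′ k j
  crossing-splitʳ e e′ i j k =
    subst (λ t → crossing e e′ i j ≡ t ⇔ Between e′ k j) (sym (crossing-reassocʳ e e′ i j k))
      (mk⇔ (+-cancelˡ-≡ (∣ i - e ∣ + H) _ _) (cong (∣ i - e ∣ + H +_)))

  shape : ∀ {X Y} → Position X Y → ℕ → ℕ → ℕ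
  shape same       i j = ∣ i - j ∣
  shape {X} ahead  i j = crossing (top X) (top (next X)) i j
  shape behind     i j = crossing 0 0 i j

  shape-cross : ∀ {X Y} i j → X ≢ Y → (s : Position X Y) → H ≤ shape s i j
  shape-cross i j X≢X same = contradiction refl X≢X
  shape-cross {X} i j _ ahead = crossing-≥ (top X) (top (next X)) i j
  shape-cross i j _ behind = crossing-≥ 0 0 i j

  shape-< : ∀ {X Y i j} (s : Position X Y) → i ≤ B → j ≤ B → shape s i j < H + H
  shape-< same i≤B j≤B =
    <-≤-trans (s≤s (≤-trans (∣-∣-bounded i≤B j≤B) (m≤m+n B B))) (m≤m+n H H)
  shape-< {X} {i = i} {j} ahead i≤B j≤B =
    crossing-< (top X) (top (next X)) i j (∣-∣-bounded i≤B (top≤B X)) (∣-∣-bounded (top≤B (next X)) j≤B)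
  shape-< {i = i} {j} behind i≤B j≤B = crossing-< 0 0 i j (∣-∣-bounded i≤B z≤n) (∣-∣-bounded z≤n j≤B)

  shape-triangleˡ : ∀ {X Y} (s : Position X Y) i j k → shape s i j ≤ ∣ i - k ∣ + shape s k j
  shape-triangleˡ same   i j k = ∣-∣-triangle i k j
  shape-triangleˡ {X} ahead i j k = crossing-triangleˡ (top X) (top (next X)) i j k
  shape-triangleˡ behind i j k = crossing-triangleˡ 0 0 i j k

  shape-triangleʳ : ∀ {X Y} (s : Position X Y) i j k → shape s i j ≤ shape s i k + ∣ k - j ∣
  shape-triangleʳ same   i j k = ∣-∣-triangle i k j
  shape-triangleʳ {X} ahead i j k = crossing-triangleʳ (top X) (top (next X)) i j k
  shape-triangleʳ behind i j k = crossing-triangleʳ 0 0 i j k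

  dist : Point → Point → ℕ
  dist (X , i) (Y , j) = shape (position X Y) (toℕ i) (toℕ j)

  dist-within : ∀ X (i j : Index X) → dist (X , i) (X , j) ≡ ∣ toℕ i - toℕ j ∣
  dist-within P _ _ = refl
  dist-within Q _ _ = refl
  dist-within R _ _ = refl

  dist-to-next : ∀ X (i : Index X) (j : Index (next X)) →
    dist (X , i) (next X , j) ≡ crossing (top X) (top (next X)) (toℕ i) (toℕ j)
  dist-to-next P _ _ = refl
  dist-to-next Q _ _ = refl
  dist-to-next R _ _ = refl

  dist-to-prev : ∀ X (i : Index X) (j : Index (prev X)) →
    dist (X , i) (prev X , j) ≡ crossing 0 0 (toℕ i) (toℕ j)
  dist-to-prev P _ _ = refl
  dist-to-prev Q _ _ = refl
  dist-to-prev R _ _ = refl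

  dist-from-next : ∀ X (i : Index (next X)) (j : Index X) →
    dist (next X , i) (X , j) ≡ crossing 0 0 (toℕ i) (toℕ j)
  dist-from-next P _ _ = refl
  dist-from-next Q _ _ = refl
  dist-from-next R _ _ = refl

  dist-from-prev : ∀ X (i : Index (prev X)) (j : Index X) →
    dist (prev X , i) (X , j) ≡ crossing (top (prev X)) (top X) (toℕ i) (toℕ j)
  dist-from-prev P _ _ = refl
  dist-from-prev Q _ _ = refl
  dist-from-prev R _ _ = refl

  dist-self : ∀ a → dist a a ≡ 0
  dist-self (X , i) = trans (dist-within X i i) (∣n-n∣≡0 (toℕ i))

  dist-cross : ∀ a b → proj₁ a ≢ proj₁ b → H ≤ dist a b
  dist-cross (X , i) (Y , j) X≢Y = shape-cross (toℕ i) (toℕ j) X≢Y (position X Y)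

  dist-< : ∀ a b → dist a b < H + H
  dist-< (X , i) (Y , j) = shape-< (position X Y) (index≤B i) (index≤B j)

  dist-far : ∀ a b c → proj₁ c ≢ proj₁ a → proj₁ c ≢ proj₁ b → dist a b < dist a c + dist c b
  dist-far a b c c≢a c≢b =
    <-≤-trans (dist-< a b) (+-mono-≤ (dist-cross a c (c≢a ∘ sym)) (dist-cross c b c≢b))

  dist≡0⇒≡ : ∀ a b → dist a b ≡ 0 → a ≡ b
  dist≡0⇒≡ (X , i) (Y , j) d≡0 with X ≟ Y
  ... | yes refl = cong (X ,_) (toℕ-injective (∣m-n∣≡0⇒m≡n (trans (sym (dist-within X i j)) d≡0)))
  ... | no X≢Y   = contradiction (subst (H ≤_) d≡0 (dist-cross (X , i) (Y , j) X≢Y)) λ ()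

  dist-triangle : ∀ a b c → dist a b ≤ dist a c + dist c b
  dist-triangle (X , i) (Y , j) (Z , k) with Z ≟ X | Z ≟ Y
  ... | yes refl | _ = subst (λ t → dist (Z , i) (Y , j) ≤ t + dist (Z , k) (Y , j))
    (sym (dist-within Z i k)) (shape-triangleˡ (position Z Y) (toℕ i) (toℕ j) (toℕ k))
  ... | no _ | yes refl = subst (λ t → dist (X , i) (Z , j) ≤ dist (X , i) (Z , k) + t)
    (sym (dist-within Z k j)) (shape-triangleʳ (position X Z) (toℕ i) (toℕ j) (toℕ k))
  ... | no Z≢X | no Z≢Y = <⇒≤ (dist-far (X , i) (Y , j) (Z , k) Z≢X Z≢Y)

  -- Collinearity

  collinear-within : ∀ X (i j k : Index X) → Collinear dist (X , i) (X , j) (X , k)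
  collinear-within X i j k =
    Sum.map (from (eq k j k i i j)) (Sum.map (from (eq i j i k k j)) (from (eq i k i j j k)))
      (between-total (toℕ i) (toℕ j) (toℕ k))
    where
    eq : ∀ a b c d e f → dist (X , a) (X , b) ≡ dist (X , c) (X , d) + dist (X , e) (X , f) ⇔
                         ∣ toℕ a - toℕ b ∣ ≡ ∣ toℕ c - toℕ d ∣ + ∣ toℕ e - toℕ f ∣
    eq a b c d e f = +-eq-transport (dist-within X a b) (dist-within X c d) (dist-within X e f)

  collinear-source : ∀ {X Y} e e′ → (∀ u v → dist (X , u) (Y , v) ≡ crossing e e′ (toℕ u) (toℕ v)) →
    ∀ {i k : Index X} {j : Index Y} →
    Between (toℕ i) (toℕ k) e ⊎ Between (toℕ k) (toℕ i) e → Collinear dist (X , i) (Y , j) (X , k)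
  collinear-source {X} e e′ cross {i} {k} {j} (inj₁ i-k-e) = inj₂ (inj₁
    (from (+-eq-transport (cross i j) (dist-within X i k) (cross k j))
          (from (crossing-splitˡ e e′ (toℕ i) (toℕ j) (toℕ k)) i-k-e)))
  collinear-source {X} e e′ cross {i} {k} {j} (inj₂ k-i-e) = inj₁
    (from (+-eq-transport (cross k j) (dist-within X k i) (cross i j))
          (from (crossing-splitˡ e e′ (toℕ k) (toℕ j) (toℕ i)) k-i-e))

  collinear-target : ∀ {X Y} e e′ → (∀ u v → dist (X , u) (Y , v) ≡ crossing e e′ (toℕ u) (toℕ v)) →
    ∀ {i : Index X} {j k : Index Y} →
    Between (toℕ j) (toℕ k) e′ ⊎ Between (toℕ k) (toℕ j) e′ → Collinear dist (X , i) (Y , j) (Y , k)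
  collinear-target {Y = Y} e e′ cross {i} {j} {k} (inj₁ j-k-e′) = inj₂ (inj₁
    (from (+-eq-transport (cross i j) (cross i k) (dist-within Y k j))
          (from (crossing-splitʳ e e′ (toℕ i) (toℕ j) (toℕ k)) (between-sym (toℕ j) (toℕ k) e′ j-k-e′))))
  collinear-target {Y = Y} e e′ cross {i} {j} {k} (inj₂ k-j-e′) = inj₂ (inj₂
    (from (+-eq-transport (cross i k) (cross i j) (dist-within Y j k))
          (from (crossing-splitʳ e e′ (toℕ i) (toℕ k) (toℕ j)) (between-sym (toℕ k) (toℕ j) e′ k-j-e′))))

  collinear-apart⇔ : ∀ {X Z} f f′ e e′ → Z ≢ X →
    (∀ u v → dist (Z , u) (X , v) ≡ crossing f f′ (toℕ u) (toℕ v)) →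
    (∀ u v → dist (X , u) (Z , v) ≡ crossing e e′ (toℕ u) (toℕ v)) →
    ∀ {i j : Index X} {k : Index Z} →
    Collinear dist (X , i) (X , j) (Z , k) ⇔ (Between f′ (toℕ i) (toℕ j) ⊎ Between (toℕ i) (toℕ j) e)
  collinear-apart⇔ {X} {Z} f f′ e e′ Z≢X from-Z to-Z {i} {j} {k} =
    mk⇔ on-line (Sum.map (from c-a-b⇔) (inj₂ ∘ from a-b-c⇔))
    where
    c-a-b⇔ : dist (Z , k) (X , j) ≡ dist (Z , k) (X , i) + dist (X , i) (X , j) ⇔
             Between f′ (toℕ i) (toℕ j)
    c-a-b⇔ = crossing-splitʳ f f′ (toℕ k) (toℕ j) (toℕ i)
        ⇔-∘ +-eq-transport (from-Z k j) (from-Z k i) (dist-within X i j)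
    a-b-c⇔ : dist (X , i) (Z , k) ≡ dist (X , i) (X , j) + dist (X , j) (Z , k) ⇔
             Between (toℕ i) (toℕ j) e
    a-b-c⇔ = crossing-splitˡ e e′ (toℕ i) (toℕ k) (toℕ j)
        ⇔-∘ +-eq-transport (to-Z i k) (dist-within X i j) (to-Z j k)
    on-line : Collinear dist (X , i) (X , j) (Z , k) →
              Between f′ (toℕ i) (toℕ j) ⊎ Between (toℕ i) (toℕ j) e
    on-line (inj₁ c-a-b)        = inj₁ (to c-a-b⇔ c-a-b)
    on-line (inj₂ (inj₁ a-c-b)) = contradiction a-c-b (<⇒≢ (dist-far (X , i) (X , j) (Z , k) Z≢X Z≢X))
    on-line (inj₂ (inj₂ a-b-c)) = inj₂ (to a-b-c⇔ a-b-c)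

  not-collinear-far : ∀ {X Y Z} {i : Index X} {j : Index Y} {k : Index Z} →
    Z ≢ X → Z ≢ Y → X ≢ Y → ¬ Collinear dist (X , i) (Y , j) (Z , k)
  not-collinear-far {i = i} {j} {k} Z≢X Z≢Y X≢Y (inj₁ c-a-b) =
    <⇒≢ (dist-far (_ , k) (_ , j) (_ , i) (Z≢X ∘ sym) X≢Y) c-a-b
  not-collinear-far {i = i} {j} {k} Z≢X Z≢Y X≢Y (inj₂ (inj₁ a-c-b)) =
    <⇒≢ (dist-far (_ , i) (_ , j) (_ , k) Z≢X Z≢Y) a-c-b
  not-collinear-far {i = i} {j} {k} Z≢X Z≢Y X≢Y (inj₂ (inj₂ a-b-c)) =
    <⇒≢ (dist-far (_ , i) (_ , k) (_ , j) (X≢Y ∘ sym) (Z≢Y ∘ sym)) a-b-c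

  collinear-next⇔ : ∀ X {i j : Index X} {k : Index (next X)} →
    Collinear dist (X , i) (X , j) (next X , k) ⇔ toℕ i ≤ toℕ j
  collinear-next⇔ X {i} {j} {k} = mk⇔
    ([ between-0 , between-≤ (toℕ≤pred[n] i) ]′ ∘ to apart)
    (from apart ∘ inj₂ ∘ λ i≤j → ≤-between i≤j (toℕ≤pred[n] j))
    where
    apart : Collinear dist (X , i) (X , j) (next X , k) ⇔
            (Between 0 (toℕ i) (toℕ j) ⊎ Between (toℕ i) (toℕ j) (top X))
    apart = collinear-apart⇔ 0 0 (top X) (top (next X)) (next≢ X) (dist-from-next X) (dist-to-next X)

  collinear-prev⇔ : ∀ X {i j : Index X} {k : Index (prev X)} →
    Collinear dist (X , i) (X , j) (prev X , k) ⇔ toℕ j ≤ toℕ i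
  collinear-prev⇔ X {i} {j} {k} = mk⇔
    ([ between-≤ (toℕ≤pred[n] j) ∘ between-sym (top X) (toℕ i) (toℕ j)
     , between-0 ∘ between-sym (toℕ i) (toℕ j) 0 ]′ ∘ to apart)
    (from apart ∘ inj₂ ∘ ≥-between z≤n)
    where
    apart : Collinear dist (X , i) (X , j) (prev X , k) ⇔
            (Between (top X) (toℕ i) (toℕ j) ⊎ Between (toℕ i) (toℕ j) 0)
    apart = collinear-apart⇔ (top (prev X)) (top X) 0 0 (prev≢ X) (dist-from-prev X) (dist-to-prev X)

  omitted : ∀ {X Y} {A : Set} → Position X Y → Dec A → Cls
  omitted {X} same   (yes _) = prev X
  omitted {X} same   (no _)  = next X
  omitted {X} ahead  _       = prev X
  omitted {X} behind _       = next X

  excluded : Point → Point → Cls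
  excluded (X , i) (Y , j) = omitted (position X Y) (toℕ i ≤? toℕ j)

  collinear-off-omitted : ∀ {X Y Z} {i : Index X} {j : Index Y} {k : Index Z}
    (s : Position X Y) (t : Position X Z) (d : Dec (toℕ i ≤ toℕ j)) →
    Z ≢ omitted s d → Collinear dist (X , i) (Y , j) (Z , k)
  collinear-off-omitted {X} same same _ _ = collinear-within X _ _ _
  collinear-off-omitted {X} same ahead (yes i≤j) _ = from (collinear-next⇔ X) i≤j
  collinear-off-omitted same ahead (no _) Z∉ = contradiction refl Z∉
  collinear-off-omitted same behind (yes _) Z∉ = contradiction refl Z∉
  collinear-off-omitted {X} same behind (no i≰j) _ = from (collinear-prev⇔ X) (≰⇒≥ i≰j)
  collinear-off-omitted {X} {i = i} {k = k} ahead same _ _ =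
    collinear-source (top X) (top (next X)) (dist-to-next X)
      (endpoint-between (toℕ≤pred[n] i) (toℕ≤pred[n] k))
  collinear-off-omitted {X} {j = j} {k} ahead ahead _ _ =
    collinear-target (top X) (top (next X)) (dist-to-next X)
      (endpoint-between (toℕ≤pred[n] j) (toℕ≤pred[n] k))
  collinear-off-omitted ahead behind _ Z∉ = contradiction refl Z∉
  collinear-off-omitted {X} {i = i} {k = k} behind same _ _ =
    collinear-source 0 0 (dist-to-prev X) (zero-endpoint-between (toℕ i) (toℕ k))
  collinear-off-omitted behind ahead _ Z∉ = contradiction refl Z∉
  collinear-off-omitted {X} {j = j} {k} behind behind _ _ =
    collinear-target 0 0 (dist-to-prev X) (zero-endpoint-between (toℕ j) (toℕ k))

  not-collinear-omitted : ∀ {X Y} {i : Index X} {j : Index Y}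
    (s : Position X Y) (d : Dec (toℕ i ≤ toℕ j)) {k : Index (omitted s d)} →
    (X , i) ≢ (Y , j) → ¬ Collinear dist (X , i) (Y , j) (omitted s d , k)
  not-collinear-omitted {X} same (yes i≤j) a≢b col =
    a≢b (cong (X ,_) (toℕ-injective (≤-antisym i≤j (to (collinear-prev⇔ X) col))))
  not-collinear-omitted {X} same (no i≰j) _ col = i≰j (to (collinear-next⇔ X) col)
  not-collinear-omitted {X} ahead  _ _ = not-collinear-far (prev≢ X) (prev≢next X) (next≢ X ∘ sym)
  not-collinear-omitted {X} behind _ _ = not-collinear-far (next≢ X) (prev≢next X ∘ sym) (prev≢ X ∘ sym)

  collinear⇔ : ∀ a b c → a ≢ b → Collinear dist a b c ⇔ proj₁ c ≢ excluded a b
  collinear⇔ (X , i) (Y , j) (Z , k) a≢b =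
    mk⇔ (λ col Z≡ → off-line Z≡ col)
        (collinear-off-omitted (position X Y) (position X Z) (toℕ i ≤? toℕ j))
    where
    off-line : ∀ {W} {k : Index W} → W ≡ excluded (X , i) (Y , j) →
      ¬ Collinear dist (X , i) (Y , j) (W , k)
    off-line refl = not-collinear-omitted (position X Y) (toℕ i ≤? toℕ j) a≢b

  -- Points as elements of Fin N

  N : ℕ
  N = size P + size Q + size R

  encode : Point → Fin N
  encode (P , i) = (i ↑ˡ size Q) ↑ˡ size R
  encode (Q , i) = (size P ↑ʳ i) ↑ˡ size R
  encode (R , i) = (size P + size Q) ↑ʳ i

  decode : Fin N → Point
  decode x = [ [ (P ,_) , (Q ,_) ]′ ∘ splitAt (size P) , (R ,_) ]′ (splitAt (size P + size Q) x)

  decode∘encode : ∀ a → decode (encode a) ≡ a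
  decode∘encode (P , i)
    rewrite splitAt-↑ˡ (size P + size Q) (i ↑ˡ size Q) (size R) | splitAt-↑ˡ (size P) i (size Q) = refl
  decode∘encode (Q , i)
    rewrite splitAt-↑ˡ (size P + size Q) (size P ↑ʳ i) (size R) | splitAt-↑ʳ (size P) (size Q) i = refl
  decode∘encode (R , i)
    rewrite splitAt-↑ʳ (size P + size Q) (size R) i = refl

  encode∘decode : ∀ x → encode (decode x) ≡ x
  encode∘decode x with splitAt (size P + size Q) x in split-x
  ... | inj₂ _ = join-of-split split-x
  ... | inj₁ y with splitAt (size P) y in split-y
  ...   | inj₁ _ = trans (cong (_↑ˡ size R) (join-of-split split-y)) (join-of-split split-x)
  ...   | inj₂ _ = trans (cong (_↑ˡ size R) (join-of-split split-y)) (join-of-split split-x)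

  decode-injective : ∀ {x y} → decode x ≡ decode y → x ≡ y
  decode-injective {x} {y} e = trans (sym (encode∘decode x)) (trans (cong encode e) (encode∘decode y))

  ρ : Dist N
  ρ x y = ι (dist (decode x) (decode y))

  ρ-isQuasimetric : IsQuasimetric ρ
  ρ-isQuasimetric = ι-isQuasimetric (λ x y → dist (decode x) (decode y))
    (λ x y → decode-injective ∘ dist≡0⇒≡ (decode x) (decode y))
    (dist-self ∘ decode)
    (λ x y z → dist-triangle (decode x) (decode y) (decode z))

  ℓ : Cls → Subset N
  ℓ w = tabulate (λ x → does (¬? (proj₁ (decode x) ≟ w)))

  line≡ℓ : ∀ {a b} → a ≢ b → line ρ a b ≡ ℓ (excluded (decode a) (decode b))
  line≡ℓ {a} {b} a≢b = trans (line-ι d a b) (tabulate-cong λ c →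
    does-⇔ (collinear⇔ (decode a) (decode b) (decode c) (a≢b ∘ decode-injective))
           (collinear? d a b c) (¬? (proj₁ (decode c) ≟ excluded (decode a) (decode b))))
    where
    d : Fin N → Fin N → ℕ
    d x y = dist (decode x) (decode y)

  excluded-next-prev : ∀ w → excluded (next w , Fin.zero) (prev w , Fin.zero) ≡ w
  excluded-next-prev P = refl
  excluded-next-prev Q = refl
  excluded-next-prev R = refl

  ℓ-isLine : ∀ w → IsLine ρ (ℓ w)
  ℓ-isLine w = a , b , a≢b , (begin
    line ρ a b                          ≡⟨ line≡ℓ a≢b ⟩
    ℓ (excluded (decode a) (decode b))  ≡⟨ cong₂ (λ u v → ℓ (excluded u v))
                                                 (decode∘encode (next w , Fin.zero))
                                                 (decode∘encode (prev w , Fin.zero)) ⟩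
    ℓ (excluded (next w , Fin.zero) (prev w , Fin.zero))
                                        ≡⟨ cong ℓ (excluded-next-prev w) ⟩
    ℓ w                                 ∎)
    where
    open ≡-Reasoning
    a b : Fin N
    a = encode (next w , Fin.zero)
    b = encode (prev w , Fin.zero)
    a≢b : a ≢ b
    a≢b a≡b = prev≢next w (sym (cong proj₁ (begin
      next w , Fin.zero  ≡⟨ decode∘encode _ ⟨
      decode a           ≡⟨ cong decode a≡b ⟩
      decode b           ≡⟨ decode∘encode _ ⟩
      prev w , Fin.zero  ∎)))

  line-is-some-ℓ : ∀ a b → a ≢ b → line ρ a b ≡ ℓ R ⊎ line ρ a b ≡ ℓ Q ⊎ line ρ a b ≡ ℓ P
  line-is-some-ℓ a b a≢b = classify (excluded (decode a) (decode b)) (line≡ℓ a≢b)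
    where
    classify : ∀ w → line ρ a b ≡ ℓ w → line ρ a b ≡ ℓ R ⊎ line ρ a b ≡ ℓ Q ⊎ line ρ a b ≡ ℓ P
    classify P e = inj₂ (inj₂ e)
    classify Q e = inj₂ (inj₁ e)
    classify R e = inj₁ e

  lookup-ℓ : ∀ w a → lookup (ℓ w) (encode a) ≡ does (¬? (proj₁ a ≟ w))
  lookup-ℓ w a = trans (lookup∘tabulate (λ x → does (¬? (proj₁ (decode x) ≟ w))) (encode a))
                       (cong (λ b → does (¬? (proj₁ b ≟ w))) (decode∘encode a))

  ℓ-distinct : ∀ w w′ → w ≢ w′ → ℓ w ≢ ℓ w′
  ℓ-distinct w w′ w≢w′ ℓw≡ℓw′ = contradiction (begin
    true                                  ≡⟨ dec-true (¬? (w ≟ w′)) w≢w′ ⟨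
    does (¬? (w ≟ w′))                    ≡⟨ lookup-ℓ w′ (w , Fin.zero) ⟨
    lookup (ℓ w′) (encode (w , Fin.zero)) ≡⟨ cong (λ v → lookup v (encode (w , Fin.zero))) ℓw≡ℓw′ ⟨
    lookup (ℓ w) (encode (w , Fin.zero))  ≡⟨ lookup-ℓ w (w , Fin.zero) ⟩
    does (¬? (w ≟ w))                     ≡⟨ dec-false (¬? (w ≟ w)) (λ w≢w → w≢w refl) ⟩
    false                                 ∎) λ ()
    where open ≡-Reasoning

  count-by-class : (g : Point → Bool) → ∣ tabulate (g ∘ decode) ∣ ≡
    ∣ tabulate (g ∘ (P ,_)) ∣ + ∣ tabulate (g ∘ (Q ,_)) ∣ + ∣ tabulate (g ∘ (R ,_)) ∣
  count-by-class g = begin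
    ∣ tabulate (g ∘ decode) ∣
      ≡⟨ ∣tabulate-+∣ (size P + size Q) (size R) (g ∘ decode) ⟩
    ∣ tabulate (g ∘ decode ∘ (_↑ˡ size R)) ∣ + ∣ tabulate (g ∘ decode ∘ encode ∘ (R ,_)) ∣
      ≡⟨ cong (_+ ∣ tabulate (g ∘ decode ∘ encode ∘ (R ,_)) ∣)
              (∣tabulate-+∣ (size P) (size Q) (g ∘ decode ∘ (_↑ˡ size R))) ⟩
    ∣ tabulate (g ∘ decode ∘ encode ∘ (P ,_)) ∣ + ∣ tabulate (g ∘ decode ∘ encode ∘ (Q ,_)) ∣
      + ∣ tabulate (g ∘ decode ∘ encode ∘ (R ,_)) ∣
      ≡⟨ cong₂ _+_ (cong₂ _+_ (on-class P) (on-class Q)) (on-class R) ⟩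
    ∣ tabulate (g ∘ (P ,_)) ∣ + ∣ tabulate (g ∘ (Q ,_)) ∣ + ∣ tabulate (g ∘ (R ,_)) ∣ ∎
    where
    open ≡-Reasoning
    on-class : ∀ X → ∣ tabulate (g ∘ decode ∘ encode ∘ (X ,_)) ∣ ≡ ∣ tabulate (g ∘ (X ,_)) ∣
    on-class X = cong ∣_∣ (tabulate-cong λ i → cong g (decode∘encode (X , i)))

  size-unless : Cls → Cls → ℕ
  size-unless w X = if does (¬? (X ≟ w)) then size X else 0

  ∣ℓ∣ : ∀ w → ∣ ℓ w ∣ ≡ size-unless w P + size-unless w Q + size-unless w R
  ∣ℓ∣ w = trans (count-by-class λ a → does (¬? (proj₁ a ≟ w)))
    (cong₂ _+_ (cong₂ _+_ (by-class P) (by-class Q)) (by-class R))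
    where
    by-class : ∀ X → ∣ tabulate {n = size X} (λ _ → does (¬? (X ≟ w))) ∣ ≡ size-unless w X
    by-class X = ∣tabulate-const∣ (size X) (does (¬? (X ≟ w)))

mainTheorem9 : (n : ℕ) → n ≥ 4 → (p q r : ℕ) → p > 0 → q > 0 → r > 0 → p + q + r ≡ n →
    Σ (Dist n) λ ρ → IsQuasimetric ρ ×
      Σ (Subset n) λ ℓ₁ → Σ (Subset n) λ ℓ₂ → Σ (Subset n) λ ℓ₃ →
        (¬ (ℓ₁ ≡ ℓ₂) × ¬ (ℓ₁ ≡ ℓ₃) × ¬ (ℓ₂ ≡ ℓ₃)) ×
        (IsLine ρ ℓ₁ × IsLine ρ ℓ₂ × IsLine ρ ℓ₃) ×
        (∀ (a b : Fin n) → ¬ (a ≡ b) →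
          (line ρ a b ≡ ℓ₁) ⊎ ((line ρ a b ≡ ℓ₂) ⊎ (line ρ a b ≡ ℓ₃))) ×
        (∣ ℓ₁ ∣ ≡ p + q × ∣ ℓ₂ ∣ ≡ p + r × ∣ ℓ₃ ∣ ≡ q + r)
mainTheorem9 _ _ zero    _       _       () _  _  _
mainTheorem9 _ _ (suc _) zero    _       _  () _  _
mainTheorem9 _ _ (suc _) (suc _) zero    _  _  () _
mainTheorem9 _ _ (suc p) (suc q) (suc r) _  _  _  refl =
  ρ , ρ-isQuasimetric , ℓ R , ℓ Q , ℓ P ,
  (ℓ-distinct R Q (λ ()) , ℓ-distinct R P (λ ()) , ℓ-distinct Q P (λ ())) ,
  (ℓ-isLine R , ℓ-isLine Q , ℓ-isLine P) ,
  line-is-some-ℓ ,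
  ( trans (∣ℓ∣ R) (+-identityʳ _)
  , trans (∣ℓ∣ Q) (cong (_+ suc r) (+-identityʳ (suc p)))
  , ∣ℓ∣ P )
  where
  top : Cls → ℕ
  top P = p
  top Q = q
  top R = r
  open Ladder top
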